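{- Let $g\ge 0$ and $k\ge 2$ be integers. The number of gapsets of genus $g$ and depth at most $k$ is at most $\mathbf F^{(k)}_{g+1}$.
   Context: A gapset is a finite set $G\subset\mathbb N$ (positive integers) such that whenever $z\in G$ and $z=x+y$ with $x,y$ positive integers, then $x\in G$ or $y\in G$. Its genus is $\#G$; its multiplicity is $m(G)=\min\{s\in\mathbb N_0\setminus G: s\ne 0\}$; its conductor is $c(G)=\min\{s\in\mathbb N_0: s+n\notin G\text{ for all } n\in\mathbb N_0\}$; its depth is $\lceil c(G)/m(G)\rceil$. For an integer $k\ge 2$, the $k$-generalized Fibonacci sequence $(\mathbf F^{(k)}_n)_{n\ge -k+2}$ is defined by $\mathbf F^{(k)}_1=1$, $\mathbf F^{(k)}_i=0$ for $i\in[-k+2,0]$, and $\mathbf F^{(k)}_n=\sum_{i=1}^k\mathbf F^{(k)}_{n-i}$ for $n\ge 2$; equivalently $\mathbf F^{(k)}_{g+1}$ is the number of compositions of $g$ with all parts in $\{1,\dots,k\}$. -}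

module Defs where

open import Data.Nat using (ℕ; zero; suc; _+_; _*_; _∸_; _≤_; _<_)
open import Data.Nat.DivMod using (_/_)
open import Data.List using (List; []; _∷_; length; take; replicate)
open import Data.Nat.ListAction using (sum)
open import Data.List.Membership.Propositional using (_∈_; _∉_)
open import Data.List.Relation.Unary.AllPairs using (AllPairs)
open import Data.Product using (_×_; ∃-syntax)
open import Data.Sum using (_⊎_)
open import Relation.Binary.PropositionalEquality using (_≡_)

-- A finite set of naturals is represented canonically by a strictly
-- increasing list of its elements.
StrictlyIncreasing : List ℕ → Set
StrictlyIncreasing = AllPairs _<_

IsGapset : List ℕ → Set
IsGapset G =
  StrictlyIncreasing G
  × (∀ {z} → z ∈ G → 1 ≤ z)
  × (∀ z x y → z ∈ G → 1 ≤ x → 1 ≤ y → z ≡ x + y → x ∈ G ⊎ y ∈ G)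

genus : List ℕ → ℕ
genus = length

IsMultiplicity : List ℕ → ℕ → Set
IsMultiplicity G m = 1 ≤ m × m ∉ G × (∀ s → 1 ≤ s → s < m → s ∈ G)

IsConductor : List ℕ → ℕ → Set
IsConductor G c =
  (∀ n → c + n ∉ G) × (∀ s → (∀ n → s + n ∉ G) → c ≤ s)

-- ceiling division ⌈ c / m ⌉ (m > 0; value at m = 0 irrelevant)
⌈_/_⌉ : ℕ → ℕ → ℕ
⌈ c / zero ⌉ = 0
⌈ c / suc m ⌉ = (c + m) / suc m

DepthAtMost : ℕ → List ℕ → Set
DepthAtMost k G =
  ∃[ m ] ∃[ c ] (IsMultiplicity G m × IsConductor G c × ⌈ c / m ⌉ ≤ k)

-- k-generalized Fibonacci numbers.
-- window k n = [F_{n+1}, F_n, ..., F_{n-k+2}]  (length k)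
window : ℕ → ℕ → List ℕ
window k zero = 1 ∷ replicate (k ∸ 1) 0
window k (suc n) = sum (window k n) ∷ take (k ∸ 1) (window k n)

head0 : List ℕ → ℕ
head0 [] = 0
head0 (x ∷ _) = x

Fib : ℕ → ℕ → ℕ
Fib k zero = 0
Fib k (suc n) = head0 (window k n)

-- A gapset G of multiplicity M and depth at most k contains no multiple of M
-- and lies below its conductor, hence below k·M. Its complement is closed
-- under addition (and contains M), so for every residue 0 < r < M the column
-- r, r + M, r + 2M, … meets G in an initial segment of some length h_r, with
-- 1 ≤ h_r ≤ k because r ∈ G. Thus G is recovered from (h_1, …, h_{M-1}), a
-- composition of the genus g with parts in [1, k], and there are exactly
-- F^{(k)}_{g+1} such compositions.

module Submission where

open import Defs
open import Data.Empty using (⊥-elim)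
open import Data.List using (List; []; _∷_; length; map; _++_; take; replicate; upTo; concatMap)
open import Data.List.Properties using (length-++; length-map; length-upTo; take-map; map-replicate; ∷-injective)
open import Data.List.Membership.Propositional using (_∈_; _∉_)
open import Data.List.Membership.Propositional.Properties using (∈-map⁺; ∈-map⁻; ∈-++⁺ˡ; ∈-++⁺ʳ; ∈-++⁻; ∈-∃++; ∈-upTo⁺; ∈-upTo⁻)
open import Data.List.Membership.Propositional.Properties.WithK using (unique∧set⇒bag)
open import Data.List.Relation.Binary.BagAndSetEquality using (∼bag⇒↭)
open import Data.List.Relation.Binary.Disjoint.Propositional using (Disjoint)
open import Data.List.Relation.Binary.Permutation.Propositional using (_↭_; ↭-sym; ↭-trans; ↭⇒↭ₛ)
open import Data.List.Relation.Binary.Permutation.Propositional.Properties using (↭-length)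
open import Data.List.Relation.Binary.Pointwise using (Pointwise-≡⇒≡)
open import Data.List.Relation.Unary.All as All using (All; []; _∷_)
import Data.List.Relation.Unary.All.Properties as All
open import Data.List.Relation.Unary.AllPairs as AllPairs using ([]; _∷_)
open import Data.List.Relation.Unary.Any using (here; there)
open import Data.List.Relation.Unary.Sorted.TotalOrder using (Sorted)
open import Data.List.Relation.Unary.Sorted.TotalOrder.Properties using (AllPairs⇒Sorted; ↗↭↗⇒≋)
open import Data.List.Relation.Unary.Unique.Propositional using (Unique)
open import Data.List.Relation.Unary.Unique.Propositional.Properties using (map⁺; upTo⁺; ++⁺)
open import Data.Nat using (ℕ; zero; suc; _+_; _*_; _∸_; _≤_; _<_; _≤′_; ≤′-refl; ≤′-step; z≤n; s≤s; NonZero; >-nonZero)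
open import Data.Nat.DivMod using (_%_; _/_; m≡m%n+[m/n]*n; m%n<n; [m+kn]%n≡m%n; m<n⇒m%n≡m)
open import Data.Nat.ListAction using (sum)
open import Data.Nat.Properties
open import Data.List.Membership.DecPropositional _≟_ using (_∈?_)
open import Algebra.Properties.CommutativeSemigroup +-commutativeSemigroup using (x∙yz≈y∙xz)
open import Data.Product using (_×_; _,_; proj₁; proj₂; ∃-syntax)
open import Data.Sum using (inj₁; inj₂; [_,_]′)
open import Function using (_∘_; id; _⇔_; mk⇔)
open import Relation.Binary.PropositionalEquality
open import Relation.Nullary using (yes; no; contradiction)
open import Relation.Unary using (Decidable)

Unique∧⊆⇒length≤ : {A : Set} {xs ys : List A} → Unique xs → (∀ {x} → x ∈ xs → x ∈ ys) →
                   length xs ≤ length ys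
Unique∧⊆⇒length≤ {xs = []} _ _ = z≤n
Unique∧⊆⇒length≤ {xs = x ∷ xs} {ys} (x∉xs ∷ xs!) xs⊆ys
  with ys₁ , ys₂ , refl ← ∈-∃++ (xs⊆ys (here refl)) = begin
  suc (length xs)              ≤⟨ s≤s (Unique∧⊆⇒length≤ xs! xs⊆ys₁++ys₂) ⟩
  suc (length (ys₁ ++ ys₂))    ≡⟨ cong suc (length-++ ys₁) ⟩
  suc (length ys₁ + length ys₂) ≡⟨ +-suc (length ys₁) (length ys₂) ⟨
  length ys₁ + length (x ∷ ys₂) ≡⟨ length-++ ys₁ ⟨
  length (ys₁ ++ x ∷ ys₂)      ∎
  where
  open ≤-Reasoning
  xs⊆ys₁++ys₂ : ∀ {z} → z ∈ xs → z ∈ ys₁ ++ ys₂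
  xs⊆ys₁++ys₂ z∈xs with ∈-++⁻ ys₁ (xs⊆ys (there z∈xs))
  ... | inj₁ z∈ys₁ = ∈-++⁺ˡ z∈ys₁
  ... | inj₂ (here refl) = contradiction refl (All.lookup x∉xs z∈xs)
  ... | inj₂ (there z∈ys₂) = ∈-++⁺ʳ ys₁ z∈ys₂

injection⇒length≤ : {A B : Set} {P : A → Set} {xs : List A} {ys : List B}
                    (f : ∀ x → P x → B) →
                    (∀ {x y} (p : P x) (q : P y) → f x p ≡ f y q → x ≡ y) →
                    (∀ {x} (p : P x) → f x p ∈ ys) →
                    Unique xs → All P xs → length xs ≤ length ys
injection⇒length≤ {B = B} {P} {ys = ys} f f-injective f-into xs! Pxs =
  subst (_≤ _) (length-images Pxs) (Unique∧⊆⇒length≤ (images-unique xs! Pxs) (images-⊆ Pxs))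
  where
  images : ∀ {xs} → All P xs → List B
  images [] = []
  images {x ∷ _} (p ∷ ps) = f x p ∷ images ps

  length-images : ∀ {xs} (ps : All P xs) → length (images ps) ≡ length xs
  length-images [] = refl
  length-images (p ∷ ps) = cong suc (length-images ps)

  images-⊆ : ∀ {xs} (ps : All P xs) {b} → b ∈ images ps → b ∈ ys
  images-⊆ (p ∷ ps) (here refl) = f-into p
  images-⊆ (p ∷ ps) (there b∈) = images-⊆ ps b∈

  images-unique : ∀ {xs} → Unique xs → (ps : All P xs) → Unique (images ps)
  images-unique [] [] = []
  images-unique {x ∷ _} (x∉xs ∷ xs!) (p ∷ ps) = fresh x∉xs ps ∷ images-unique xs! ps
    where
    fresh : ∀ {ys} → All (x ≢_) ys → (qs : All P ys) → All (f x p ≢_) (images qs)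
    fresh [] [] = []
    fresh (x≢y ∷ x≢ys) (q ∷ qs) = (x≢y ∘ f-injective p q) ∷ fresh x≢ys qs

Unique∧set⇒↭ : {A : Set} {xs ys : List A} → Unique xs → Unique ys →
               (∀ {x} → x ∈ xs ⇔ x ∈ ys) → xs ↭ ys
Unique∧set⇒↭ xs! ys! xs∼ys = ∼bag⇒↭ (unique∧set⇒bag xs! ys! xs∼ys)

StrictlyIncreasing-↭⇒≡ : {xs ys : List ℕ} → StrictlyIncreasing xs → StrictlyIncreasing ys →
                         xs ↭ ys → xs ≡ ys
StrictlyIncreasing-↭⇒≡ xs↗ ys↗ xs↭ys =
  Pointwise-≡⇒≡ (↗↭↗⇒≋ ≤-totalOrder (sorted xs↗) (sorted ys↗) (↭⇒↭ₛ xs↭ys))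
  where
  sorted : ∀ {zs} → StrictlyIncreasing zs → Sorted ≤-totalOrder zs
  sorted = AllPairs⇒Sorted ≤-totalOrder ∘ AllPairs.map <⇒≤

StrictlyIncreasing⇒Unique : {xs : List ℕ} → StrictlyIncreasing xs → Unique xs
StrictlyIncreasing⇒Unique = AllPairs.map <⇒≢

-- Compositions with parts in [1, k]

BoundedParts : ℕ → List ℕ → Set
BoundedParts k = All (λ p → 1 ≤ p × p ≤ k)

entry : List (List (List ℕ)) → ℕ → List (List ℕ)
entry [] _ = []
entry (cs ∷ _) zero = cs
entry (_ ∷ css) (suc i) = entry css i

prependParts : ℕ → List (List (List ℕ)) → List (List ℕ)
prependParts p [] = []
prependParts p (cs ∷ css) = map (p ∷_) cs ++ prependParts (suc p) css

-- For i < k, entry i of compositionWindow k n lists the compositions of n − i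
-- (none if i > n) with parts in [1, k].
compositionWindow : ℕ → ℕ → List (List (List ℕ))
compositionWindow k zero = ([] ∷ []) ∷ replicate (k ∸ 1) []
compositionWindow k (suc n) = prependParts 1 W ∷ take (k ∸ 1) W
  where
  W : List (List (List ℕ))
  W = compositionWindow k n

compositions : ℕ → ℕ → List (List ℕ)
compositions k n = entry (compositionWindow k n) 0

length-prependParts : ∀ p css → length (prependParts p css) ≡ sum (map length css)
length-prependParts p [] = refl
length-prependParts p (cs ∷ css) = begin
  length (map (p ∷_) cs ++ prependParts (suc p) css)    ≡⟨ length-++ (map (p ∷_) cs) ⟩
  length (map (p ∷_) cs) + length (prependParts (suc p) css)
    ≡⟨ cong₂ _+_ (length-map (p ∷_) cs) (length-prependParts (suc p) css) ⟩
  length cs + sum (map length css)                      ∎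
  where open ≡-Reasoning

map-length-compositionWindow : ∀ k n → map length (compositionWindow k n) ≡ window k n
map-length-compositionWindow k zero = cong (1 ∷_) (map-replicate length (k ∸ 1) [])
map-length-compositionWindow k (suc n) = cong₂ _∷_
  (trans (length-prependParts 1 W) (cong sum IH))
  (trans (sym (take-map (k ∸ 1) W)) (cong (take (k ∸ 1)) IH))
  where
  W : List (List (List ℕ))
  W = compositionWindow k n
  IH : map length W ≡ window k n
  IH = map-length-compositionWindow k n

length-compositions : ∀ k n → length (compositions k n) ≡ Fib k (suc n)
length-compositions k n =
  trans (length-entry₀ (compositionWindow k n)) (cong head0 (map-length-compositionWindow k n))
  where
  length-entry₀ : ∀ css → length (entry css 0) ≡ head0 (map length css)
  length-entry₀ [] = refl
  length-entry₀ (_ ∷ _) = refl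

entry-take : ∀ {m i} css → i < m → entry (take m css) i ≡ entry css i
entry-take {suc m} [] _ = refl
entry-take {suc m} {zero} (_ ∷ _) _ = refl
entry-take {suc m} {suc i} (_ ∷ css) (s≤s i<m) = entry-take css i<m

∈-prependParts : ∀ p css i {c} → c ∈ entry css i → (p + i) ∷ c ∈ prependParts p css
∈-prependParts p (cs ∷ css) zero {c} c∈ =
  ∈-++⁺ˡ (subst (λ q → q ∷ c ∈ map (p ∷_) cs) (sym (+-identityʳ p)) (∈-map⁺ (p ∷_) c∈))
∈-prependParts p (cs ∷ css) (suc i) {c} c∈ =
  ∈-++⁺ʳ (map (p ∷_) cs)
    (subst (λ q → q ∷ c ∈ prependParts (suc p) css) (sym (+-suc p i)) (∈-prependParts (suc p) css i c∈))

∈-compositionWindow : ∀ k n {i c} → i < k → BoundedParts k c → sum c + i ≡ n →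
                      c ∈ entry (compositionWindow k n) i
∈-compositionWindow k zero {zero} {[]} _ _ _ = here refl
∈-compositionWindow k zero {zero} {_ ∷ _} _ ((s≤s _ , _) ∷ _) ()
∈-compositionWindow k zero {suc i} {c} _ _ sum+i≡0 with () ← m+n≡0⇒n≡0 (sum c) sum+i≡0
∈-compositionWindow k (suc n) {zero} {[]} _ _ ()
∈-compositionWindow k (suc n) {zero} {suc j ∷ c} _ ((_ , j<k) ∷ c-bounded) sum≡ =
  ∈-prependParts 1 (compositionWindow k n) j (∈-compositionWindow k n j<k c-bounded rest≡)
  where
  rest≡ : sum c + j ≡ n
  rest≡ = trans (+-comm (sum c) j) (trans (sym (+-identityʳ _)) (suc-injective sum≡))
∈-compositionWindow (suc k) (suc n) {suc i} {c} (s≤s i<k) c-bounded sum≡ =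
  subst (c ∈_) (sym (entry-take (compositionWindow (suc k) n) i<k))
    (∈-compositionWindow (suc k) n (m<n⇒m<1+n i<k) c-bounded
      (suc-injective (trans (sym (+-suc (sum c) i)) sum≡)))

∈-compositions : ∀ {k n c} → 1 ≤ k → BoundedParts k c → sum c ≡ n → c ∈ compositions k n
∈-compositions {k} {n} k≥1 c-bounded sum≡ =
  ∈-compositionWindow k n k≥1 c-bounded (trans (+-identityʳ _) sum≡)

initialRun : {P : ℕ → Set} → Decidable P → ℕ → ℕ
initialRun P? zero = 0
initialRun P? (suc n) with P? 0
... | yes _ = suc (initialRun (P? ∘ suc) n)
... | no _ = 0

initialRun≤ : ∀ {P} (P? : Decidable P) n → initialRun P? n ≤ n
initialRun≤ P? zero = z≤n
initialRun≤ P? (suc n) with P? 0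
... | yes _ = s≤s (initialRun≤ (P? ∘ suc) n)
... | no _ = z≤n

initialRun-sound : ∀ {P} (P? : Decidable P) n {j} → j < initialRun P? n → P j
initialRun-sound P? (suc n) {j} j<run with P? 0
initialRun-sound P? (suc n) {zero} _ | yes P0 = P0
initialRun-sound P? (suc n) {suc j} (s≤s j<run) | yes _ = initialRun-sound (P? ∘ suc) n j<run

initialRun-complete : ∀ {P} (P? : Decidable P) n {j} → (∀ {i} → i ≤ j → P i) → j < n →
                      j < initialRun P? n
initialRun-complete P? (suc n) {j} P≤j j<n with P? 0
... | no ¬P0 = contradiction (P≤j z≤n) ¬P0
initialRun-complete P? (suc n) {zero} P≤j j<n | yes _ = s≤s z≤n
initialRun-complete P? (suc n) {suc j} P≤j (s≤s j<n) | yes _ =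
  s≤s (initialRun-complete (P? ∘ suc) n (P≤j ∘ s≤s) j<n)

column : ℕ → ℕ → ℕ → List ℕ
column M r h = map (λ j → r + j * M) (upTo h)

columns : ℕ → (ℕ → ℕ) → List ℕ → List ℕ
columns M h = concatMap (λ r → column M r (h r))

length-columns : ∀ M h rs → length (columns M h rs) ≡ sum (map h rs)
length-columns M h [] = refl
length-columns M h (r ∷ rs) = begin
  length (column M r (h r) ++ columns M h rs)          ≡⟨ length-++ (column M r (h r)) ⟩
  length (column M r (h r)) + length (columns M h rs)
    ≡⟨ cong₂ _+_ (trans (length-map _ (upTo (h r))) (length-upTo (h r))) (length-columns M h rs) ⟩
  h r + sum (map h rs)                                  ∎
  where open ≡-Reasoning

columns-cong : ∀ M {h h′} rs → map h rs ≡ map h′ rs → columns M h rs ≡ columns M h′ rs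
columns-cong M [] _ = refl
columns-cong M (r ∷ rs) eq with hr≡h′r , rest ← ∷-injective eq =
  cong₂ (λ h ys → column M r h ++ ys) hr≡h′r (columns-cong M rs rest)

∈-columns⁺ : ∀ {M h rs r j} → r ∈ rs → j < h r → r + j * M ∈ columns M h rs
∈-columns⁺ (here refl) j<h = ∈-++⁺ˡ (∈-map⁺ _ (∈-upTo⁺ j<h))
∈-columns⁺ {M} {h} {r′ ∷ _} (there r∈) j<h = ∈-++⁺ʳ (column M r′ (h r′)) (∈-columns⁺ r∈ j<h)

∈-columns⁻ : ∀ {M} h rs {z} → z ∈ columns M h rs →
             ∃[ r ] ∃[ j ] (r ∈ rs × j < h r × z ≡ r + j * M)
∈-columns⁻ {M} h (r ∷ rs) z∈ with ∈-++⁻ (column M r (h r)) z∈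
... | inj₁ z∈column with j , j∈ , refl ← ∈-map⁻ _ z∈column = r , j , here refl , ∈-upTo⁻ j∈ , refl
... | inj₂ z∈columns with r′ , j , r′∈ , j<h , refl ← ∈-columns⁻ h rs z∈columns =
  r′ , j , there r′∈ , j<h , refl

column-residue : ∀ {M r} j .{{_ : NonZero M}} → r < M → (r + j * M) % M ≡ r
column-residue {M} {r} j r<M = trans ([m+kn]%n≡m%n r j M) (m<n⇒m%n≡m r<M)

columns-unique : ∀ M .{{_ : NonZero M}} h {rs} → Unique rs → All (_< M) rs → Unique (columns M h rs)
columns-unique M h [] [] = []
columns-unique M h {r ∷ rs} (r∉rs ∷ rs!) (r<M ∷ rs<M) =
  ++⁺ column-unique (columns-unique M h rs! rs<M) disjoint
  where
  column-unique : Unique (column M r (h r))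
  column-unique = map⁺ (λ {i} {j} eq → *-cancelʳ-≡ i j M (+-cancelˡ-≡ r _ _ eq)) (upTo⁺ (h r))

  disjoint : Disjoint (column M r (h r)) (columns M h rs)
  disjoint (z∈column , z∈columns)
    with j , _ , refl ← ∈-map⁻ _ z∈column
       | r′ , j′ , r′∈ , _ , eq ← ∈-columns⁻ h rs z∈columns =
    All.lookup r∉rs r′∈ (begin
      r                  ≡⟨ column-residue j r<M ⟨
      (r + j * M) % M    ≡⟨ cong (_% M) eq ⟩
      (r′ + j′ * M) % M  ≡⟨ column-residue j′ (All.lookup rs<M r′∈) ⟩
      r′                 ∎)
    where open ≡-Reasoning

nonzeroResidues : ℕ → List ℕ
nonzeroResidues M = map suc (upTo (M ∸ 1))

∈-nonzeroResidues⁺ : ∀ {M r} → 1 ≤ r → r < M → r ∈ nonzeroResidues M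
∈-nonzeroResidues⁺ {suc M} {suc r} _ (s≤s r<M) = ∈-map⁺ suc (∈-upTo⁺ r<M)

∈-nonzeroResidues⁻ : ∀ {M r} → r ∈ nonzeroResidues M → 1 ≤ r × r < M
∈-nonzeroResidues⁻ {suc M} r∈ with i , i∈ , refl ← ∈-map⁻ suc r∈ = s≤s z≤n , s≤s (∈-upTo⁻ i∈)

nonzeroResidues-unique : ∀ M → Unique (nonzeroResidues M)
nonzeroResidues-unique M = map⁺ suc-injective (upTo⁺ (M ∸ 1))

length-nonzeroResidues : ∀ M → length (nonzeroResidues M) ≡ M ∸ 1
length-nonzeroResidues M = trans (length-map suc (upTo (M ∸ 1))) (length-upTo (M ∸ 1))

module _ {G : List ℕ} (gap : IsGapset G) where

  0∉ : 0 ∉ G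
  0∉ 0∈G with () ← proj₁ (proj₂ gap) 0∈G

  +∈⇒∈ʳ : ∀ {x y} → x ∉ G → x + y ∈ G → y ∈ G
  +∈⇒∈ʳ {zero} _ x+y∈G = x+y∈G
  +∈⇒∈ʳ {suc x} {zero} x∉G x+y∈G = ⊥-elim (x∉G (subst (_∈ G) (+-identityʳ (suc x)) x+y∈G))
  +∈⇒∈ʳ {suc x} {suc y} x∉G x+y∈G =
    [ ⊥-elim ∘ x∉G , id ]′ (proj₂ (proj₂ gap) _ (suc x) (suc y) x+y∈G (s≤s z≤n) (s≤s z≤n) refl)

  ∉-+-closed : ∀ {x y} → x ∉ G → y ∉ G → x + y ∉ G
  ∉-+-closed x∉G y∉G = y∉G ∘ +∈⇒∈ʳ x∉G

  multiple∉ : ∀ {M} → M ∉ G → ∀ j → j * M ∉ G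
  multiple∉ M∉G zero = 0∉
  multiple∉ M∉G (suc j) = ∉-+-closed M∉G (multiple∉ M∉G j)

  column-downClosed : ∀ {M r i j} → M ∉ G → r + j * M ∈ G → i ≤′ j → r + i * M ∈ G
  column-downClosed M∉G r+jM∈G ≤′-refl = r+jM∈G
  column-downClosed {M} {r} {j = suc j} M∉G r+jM∈G (≤′-step i≤j) =
    column-downClosed M∉G (+∈⇒∈ʳ M∉G (subst (_∈ G) (x∙yz≈y∙xz r M (j * M)) r+jM∈G)) i≤j

∈⇒<conductor : ∀ {G c z} → IsConductor G c → z ∈ G → z < c
∈⇒<conductor {G} {c} {z} (c+n∉G , _) z∈G with c ≤? z
... | yes c≤z = ⊥-elim (c+n∉G (z ∸ c) (subst (_∈ G) (sym (m+[n∸m]≡n c≤z)) z∈G))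
... | no c≰z = ≰⇒> c≰z

⌈/⌉≤⇒≤* : ∀ {c M k} → 1 ≤ M → ⌈ c / M ⌉ ≤ k → c ≤ k * M
⌈/⌉≤⇒≤* {c} {suc m} {k} _ ⌈c/M⌉≤k = +-cancelˡ-≤ m c (k * M) (≤-pred (begin-strict
  m + c                  ≡⟨ +-comm m c ⟩
  c + m                  ≡⟨ m≡m%n+[m/n]*n (c + m) M ⟩
  (c + m) % M + (c + m) / M * M  <⟨ +-mono-<-≤ (m%n<n (c + m) M) (*-monoˡ-≤ M ⌈c/M⌉≤k) ⟩
  M + k * M              ≡⟨⟩
  suc (m + k * M)        ∎))
  where
  M : ℕ
  M = suc m
  open ≤-Reasoning

-- The height encoding of a gapset of bounded depth

height : ℕ → ℕ → List ℕ → ℕ → ℕ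
height k M G r = initialRun (λ j → r + j * M ∈? G) k

heights : ℕ → ℕ → List ℕ → List ℕ
heights k M G = map (height k M G) (nonzeroResidues M)

module _ {k G M c} (gap : IsGapset G) (mult : IsMultiplicity G M) (cond : IsConductor G c)
         (depth : ⌈ c / M ⌉ ≤ k) where

  private
    instance
      M-nonZero : NonZero M
      M-nonZero = >-nonZero (proj₁ mult)

    M∉G : M ∉ G
    M∉G = proj₁ (proj₂ mult)

    ∈⇒<k*M : ∀ {z} → z ∈ G → z < k * M
    ∈⇒<k*M z∈G = <-≤-trans (∈⇒<conductor cond z∈G) (⌈/⌉≤⇒≤* (proj₁ mult) depth)

  ∈⇒<height : ∀ {r j} → r + j * M ∈ G → j < height k M G r
  ∈⇒<height {r} {j} r+jM∈G = initialRun-complete _ k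
    (λ i≤j → column-downClosed gap M∉G r+jM∈G (≤⇒≤′ i≤j))
    (*-cancelʳ-< M j k (≤-<-trans (m≤n+m (j * M) r) (∈⇒<k*M r+jM∈G)))

  ⊆columns : ∀ {z} → z ∈ G → z ∈ columns M (height k M G) (nonzeroResidues M)
  ⊆columns {z} z∈G = subst (_∈ _) (sym z≡r+jM)
    (∈-columns⁺ (∈-nonzeroResidues⁺ r≥1 (m%n<n z M)) (∈⇒<height {r} {j} (subst (_∈ G) z≡r+jM z∈G)))
    where
    r j : ℕ
    r = z % M
    j = z / M
    z≡r+jM : z ≡ r + j * M
    z≡r+jM = m≡m%n+[m/n]*n z M
    r≥1 : 1 ≤ r
    r≥1 with z % M in r≡
    ... | zero = ⊥-elim (multiple∉ gap M∉G j (subst (_∈ G) (trans z≡r+jM (cong (_+ j * M) r≡)) z∈G))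
    ... | suc _ = s≤s z≤n

  columns⊆ : ∀ {z} → z ∈ columns M (height k M G) (nonzeroResidues M) → z ∈ G
  columns⊆ z∈ with r , j , _ , j<h , refl ← ∈-columns⁻ (height k M G) (nonzeroResidues M) z∈ =
    initialRun-sound _ k j<h

  ↭columns : G ↭ columns M (height k M G) (nonzeroResidues M)
  ↭columns = Unique∧set⇒↭ (StrictlyIncreasing⇒Unique (proj₁ gap))
    (columns-unique M (height k M G) (nonzeroResidues-unique M)
      (All.tabulate (proj₂ ∘ ∈-nonzeroResidues⁻)))
    (mk⇔ ⊆columns columns⊆)

  genus≡sum-heights : genus G ≡ sum (heights k M G)
  genus≡sum-heights = trans (↭-length ↭columns) (length-columns M _ (nonzeroResidues M))

  heights-bounded : BoundedParts k (heights k M G)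
  heights-bounded = All.map⁺ (All.tabulate bounded)
    where
    bounded : ∀ {r} → r ∈ nonzeroResidues M → 1 ≤ height k M G r × height k M G r ≤ k
    bounded {r} r∈ with r≥1 , r<M ← ∈-nonzeroResidues⁻ r∈ =
      ∈⇒<height {j = 0} (subst (_∈ G) (sym (+-identityʳ r)) (proj₂ (proj₂ mult) r r≥1 r<M)) ,
      initialRun≤ _ k

length-heights : ∀ k M G → length (heights k M G) ≡ M ∸ 1
length-heights k M G = trans (length-map (height k M G) (nonzeroResidues M)) (length-nonzeroResidues M)

heights-injective : ∀ {k G G′} → IsGapset G → IsGapset G′ →
                    (d : DepthAtMost k G) (d′ : DepthAtMost k G′) →
                    heights k (proj₁ d) G ≡ heights k (proj₁ d′) G′ → G ≡ G′
heights-injective {k} {G} {G′} gap gap′ (M , _ , mult , cond , depth) (M′ , _ , mult′ , cond′ , depth′) eq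
  with refl ← ∸-cancelʳ-≡ (proj₁ mult) (proj₁ mult′)
                (trans (sym (length-heights k M G)) (trans (cong length eq) (length-heights k M′ G′))) =
  StrictlyIncreasing-↭⇒≡ (proj₁ gap) (proj₁ gap′) (↭-trans (↭columns gap mult cond depth) columns↭G′)
  where
  columns↭G′ : columns M (height k M G) (nonzeroResidues M) ↭ G′
  columns↭G′ = subst (_↭ G′) (columns-cong M (nonzeroResidues M) (sym eq))
                 (↭-sym (↭columns gap′ mult′ cond′ depth′))

proposition4p5 : (g k : ℕ) → 2 ≤ k → (Gs : List (List ℕ)) → Unique Gs
    → All (λ G → IsGapset G × genus G ≡ g × DepthAtMost k G) Gs
    → length Gs ≤ Fib k (suc g)
proposition4p5 g k k≥2 Gs Gs! Gs-valid =
  subst (length Gs ≤_) (length-compositions k g)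
    (injection⇒length≤ code code-injective code∈compositions Gs! Gs-valid)
  where
  Valid : List ℕ → Set
  Valid G = IsGapset G × genus G ≡ g × DepthAtMost k G

  code : ∀ G → Valid G → List ℕ
  code G (_ , _ , M , _) = heights k M G

  code-injective : ∀ {G G′} (p : Valid G) (q : Valid G′) → code G p ≡ code G′ q → G ≡ G′
  code-injective (gap , _ , d) (gap′ , _ , d′) = heights-injective gap gap′ d d′

  code∈compositions : ∀ {G} (p : Valid G) → code G p ∈ compositions k g
  code∈compositions (gap , genus≡g , _ , _ , mult , cond , depth) =
    ∈-compositions (<⇒≤ k≥2) (heights-bounded gap mult cond depth)
      (trans (sym (genus≡sum-heights gap mult cond depth)) genus≡g)
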